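{- Let $\mathcal{P}_\omega$ be the set of partitions $\lambda=(\lambda_1\ge\cdots\ge\lambda_\ell)$ with parts in $\mathbb{Z}_{\ge0}$ (a part $0$ is allowed) whose smallest part is unique ($\lambda_{\ell-1}>\lambda_\ell$ when $\ell\ge2$) and such that every odd part $\lambda_i$ satisfies $\lambda_i\le2\lambda_\ell+1$. For $\lambda=(\lambda_1,\dots,\lambda_\ell)\in\mathcal{P}_\omega$ define $\psi_2^+(\lambda)=(\lambda_1+2,\dots,\lambda_{\ell-1}+2,\lambda_\ell+1)$ and define $\psi_1^+(\lambda)$ as follows. Let $\phi^+(\lambda)$ be the nonincreasing rearrangement of $(\lambda_1,\dots,\lambda_{\ell-1},\lambda_\ell+1)$. (i) If $\lambda_\ell$ is odd and $\lambda_i$ is even for all $1\le i\le\ell-1$: $\psi_1^+(\lambda)$ is $\phi^+(\lambda)$ with an extra part $0$ appended at the end; (ii) otherwise: choose a largest odd part $\kappa$ of $\phi^+(\lambda)$, and let $\psi_1^+(\lambda)$ be the nonincreasing rearrangement of the sequence obtained from $\phi^+(\lambda)$ by removing this part $\kappa$ and adding the two parts $(\kappa+1)/2$ and $(\kappa-1)/2$. Then $\psi_1^+(\lambda)\in\mathcal{P}_\omega$ and $\psi_2^+(\lambda)\in\mathcal{P}_\omega$. -}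

module Defs where

open import Data.Nat using (ℕ; zero; suc; _+_; _*_; _≤_; _<_; _≥_; _≤ᵇ_; _%_; _/_)
open import Data.Bool using (Bool; true; false; if_then_else_)
open import Data.List using (List; []; _∷_; _∷ʳ_; _++_; [_])
open import Data.List.Relation.Unary.All using (All)
open import Data.List.Relation.Unary.Linked using (Linked)
open import Data.Product using (∃₂; _×_)
open import Relation.Binary.PropositionalEquality using (_≡_)

Odd : ℕ → Set
Odd n = n % 2 ≡ 1

isOdd : ℕ → Bool
isOdd n with n % 2
... | 1 = true
... | _ = false

InPω : List ℕ → Set
InPω l = Linked _≥_ l ×
         ∃₂ λ (xs : List ℕ) (a : ℕ) →
           (l ≡ xs ∷ʳ a) × All (a <_) xs × All (λ x → Odd x → x ≤ 2 * a + 1) l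

insertDesc : ℕ → List ℕ → List ℕ
insertDesc x [] = x ∷ []
insertDesc x (y ∷ ys) = if y ≤ᵇ x then x ∷ y ∷ ys else y ∷ insertDesc x ys

sortDesc : List ℕ → List ℕ
sortDesc [] = []
sortDesc (x ∷ xs) = insertDesc x (sortDesc xs)

-- Below, a partition λ = (λ₁,…,λ_{ℓ-1},λ_ℓ) is passed as (xs , a) with
-- xs = (λ₁,…,λ_{ℓ-1}) and a = λ_ℓ.

ψ₂⁺ : List ℕ → ℕ → List ℕ
ψ₂⁺ xs a = Data.List.map (_+ 2) xs ∷ʳ (a + 1)
  where import Data.List

φ⁺ : List ℕ → ℕ → List ℕ
φ⁺ xs a = sortDesc (xs ∷ʳ suc a)

allEven : List ℕ → Bool
allEven [] = true
allEven (x ∷ xs) = if isOdd x then false else allEven xs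

-- largest odd part of a list (0 if there is none; only used when one exists)
maxOdd : List ℕ → ℕ
maxOdd [] = 0
maxOdd (x ∷ xs) with isOdd x
... | true  = Data.Nat._⊔_ x (maxOdd xs) where import Data.Nat
... | false = maxOdd xs

removeOne : ℕ → List ℕ → List ℕ
removeOne k [] = []
removeOne k (x ∷ xs) = if Data.Nat._≡ᵇ_ x k then xs else x ∷ removeOne k xs
  where import Data.Nat

ψ₁⁺ : List ℕ → ℕ → List ℕ
ψ₁⁺ xs a with isOdd a | allEven xs
... | true | true = φ⁺ xs a ∷ʳ 0
... | _    | _    =
  let φ = φ⁺ xs a
      κ = maxOdd φ
  in sortDesc (((κ + 1) / 2) ∷ ((Data.Nat._∸_ κ 1) / 2) ∷ removeOne κ φ)
  where import Data.Nat

module Submission where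

-- ψ₂⁺ is direct: adding 2 to the non-final parts and 1 to the smallest part
-- keeps the list nonincreasing and the smallest part unique, and it raises
-- the bound 2a+1 on odd parts by exactly 2.
--
-- For ψ₁⁺ let λ = (xs, a) and φ = φ⁺(λ).  Every part of φ exceeds a and every
-- odd part of φ is at most 2a+1.  In case (i) φ has no odd part at all, so
-- φ with a 0 appended lies in 𝒫_ω (the bound 2·0+1 on odd parts is vacuous).
-- In case (ii) φ has an odd part, so its largest odd part is κ = 2m+1 with
-- m ≤ a; the remaining parts R all exceed m and their odd parts are at most
-- 2m+1, while κ is replaced by m+1 and m.

open import Defs
open import Data.Nat using (ℕ; zero; suc; _+_; _*_; _∸_; _≤_; _<_; _≥_; _≤ᵇ_; _%_; _/_; _≡ᵇ_; z≤n; s≤s)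
open import Data.Nat.Properties
open import Data.Nat.DivMod using (m≡m%n+[m/n]*n; m*n/n≡m)
open import Data.Nat.Tactic.RingSolver using (solve-∀)
open import Data.Bool using (true; false; T)
open import Data.Unit using (tt)
open import Data.Empty using (⊥-elim)
open import Data.List using (List; []; _∷_; _∷ʳ_; map)
open import Data.List.Properties using (∷ʳ-injective)
open import Data.List.Relation.Unary.All as All using (All; []; _∷_)
open import Data.List.Relation.Unary.All.Properties using (∷ʳ⁺; ∷ʳ⁻; map⁺)
open import Data.List.Relation.Unary.Any using (Any; here; there)
open import Data.List.Relation.Unary.Any.Properties using (++⁺ˡ; ++⁺ʳ)
open import Data.List.Relation.Unary.Linked as Linked using (Linked; []; [-]; _∷_)
import Data.List.Relation.Unary.Linked.Properties as Linkedₚ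
open import Data.List.Relation.Binary.Permutation.Propositional using (_↭_; ↭-refl; ↭-prep; ↭-swap; ↭-trans; ↭-sym)
open import Data.List.Relation.Binary.Permutation.Propositional.Properties using (All-resp-↭; Any-resp-↭)
open import Data.Product using (_×_; _,_; ∃; proj₁)
open import Data.Sum using (_⊎_; inj₁; inj₂)
open import Relation.Nullary using (¬_)
open import Relation.Binary.PropositionalEquality using (_≡_; refl; sym; cong; subst; module ≡-Reasoning)

isOdd⇒Odd : ∀ n → isOdd n ≡ true → Odd n
isOdd⇒Odd n e with n % 2
... | 1 = refl
... | 0 with () ← e
... | suc (suc _) with () ← e

isOdd⇒¬Odd : ∀ n → isOdd n ≡ false → ¬ Odd n
isOdd⇒¬Odd n e o with n % 2
... | 1 with () ← e
isOdd⇒¬Odd n e () | 0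
isOdd⇒¬Odd n e () | suc (suc _)

Odd⇒¬Odd-suc : ∀ n → Odd n → ¬ Odd (suc n)
Odd⇒¬Odd-suc zero () _
Odd⇒¬Odd-suc (suc zero) _ ()
Odd⇒¬Odd-suc (suc (suc n)) = Odd⇒¬Odd-suc n

¬Odd⇒Odd-suc : ∀ n → ¬ Odd n → Odd (suc n)
¬Odd⇒Odd-suc zero _ = refl
¬Odd⇒Odd-suc (suc zero) ¬o = ⊥-elim (¬o refl)
¬Odd⇒Odd-suc (suc (suc n)) = ¬Odd⇒Odd-suc n

Odd-+2⁻ : ∀ n → Odd (n + 2) → Odd n
Odd-+2⁻ n o rewrite +-comm n 2 = o

Odd⇒2m+1 : ∀ n → Odd n → ∃ λ m → n ≡ 2 * m + 1
Odd⇒2m+1 n o = n / 2 , (begin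
  n                 ≡⟨ m≡m%n+[m/n]*n n 2 ⟩
  n % 2 + n / 2 * 2 ≡⟨ cong (_+ n / 2 * 2) o ⟩
  1 + n / 2 * 2     ≡⟨ +-comm 1 (n / 2 * 2) ⟩
  n / 2 * 2 + 1     ≡⟨ cong (_+ 1) (*-comm (n / 2) 2) ⟩
  2 * (n / 2) + 1   ∎)
  where open ≡-Reasoning

half-up : ∀ m → (2 * m + 1 + 1) / 2 ≡ suc m
half-up m = begin
  (2 * m + 1 + 1) / 2 ≡⟨ cong (_/ 2) (twice-suc m) ⟩
  suc m * 2 / 2       ≡⟨ m*n/n≡m (suc m) 2 ⟩
  suc m               ∎
  where
  open ≡-Reasoning
  twice-suc : ∀ k → 2 * k + 1 + 1 ≡ suc k * 2
  twice-suc = solve-∀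

half-down : ∀ m → (2 * m + 1 ∸ 1) / 2 ≡ m
half-down m = begin
  (2 * m + 1 ∸ 1) / 2 ≡⟨ cong (_/ 2) (m+n∸n≡m (2 * m) 1) ⟩
  2 * m / 2           ≡⟨ cong (_/ 2) (*-comm 2 m) ⟩
  m * 2 / 2           ≡⟨ m*n/n≡m m 2 ⟩
  m                   ∎
  where open ≡-Reasoning

m≤2m+1 : ∀ m → m ≤ 2 * m + 1
m≤2m+1 m = ≤-trans (m≤m+n m (m + 0)) (m≤m+n (2 * m) 1)

1+m≤2m+1 : ∀ m → suc m ≤ 2 * m + 1
1+m≤2m+1 m = subst (_≤ 2 * m + 1) (+-comm m 1) (+-monoˡ-≤ 1 (m≤m+n m (m + 0)))

2m+1-cancel-≤ : ∀ m a → 2 * m + 1 ≤ 2 * a + 1 → m ≤ a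
2m+1-cancel-≤ m a h = *-cancelˡ-≤ 2 (+-cancelʳ-≤ 1 (2 * m) (2 * a) h)

≤ᵇ-true⇒≤ : ∀ {y x} → (y ≤ᵇ x) ≡ true → y ≤ x
≤ᵇ-true⇒≤ {y} {x} e = ≤ᵇ⇒≤ y x (subst T (sym e) tt)

≤ᵇ-false⇒> : ∀ {y x} → (y ≤ᵇ x) ≡ false → x < y
≤ᵇ-false⇒> e = ≰⇒> (λ y≤x → subst T e (≤⇒≤ᵇ y≤x))

insertDesc-↭ : ∀ x ys → insertDesc x ys ↭ x ∷ ys
insertDesc-↭ x [] = ↭-refl
insertDesc-↭ x (y ∷ ys) with y ≤ᵇ x
... | true = ↭-refl
... | false = ↭-trans (↭-prep y (insertDesc-↭ x ys)) (↭-swap y x ↭-refl)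

sortDesc-↭ : ∀ l → sortDesc l ↭ l
sortDesc-↭ [] = ↭-refl
sortDesc-↭ (x ∷ l) = ↭-trans (insertDesc-↭ x (sortDesc l)) (↭-prep x (sortDesc-↭ l))

module _ {P : ℕ → Set} where

  All-insertDesc : ∀ {x ys} → P x → All P ys → All P (insertDesc x ys)
  All-insertDesc {x} {ys} px pys = All-resp-↭ (↭-sym (insertDesc-↭ x ys)) (px ∷ pys)

  All-sortDesc : ∀ {l} → All P l → All P (sortDesc l)
  All-sortDesc {l} = All-resp-↭ (↭-sym (sortDesc-↭ l))

  Any-sortDesc : ∀ {l} → Any P l → Any P (sortDesc l)
  Any-sortDesc {l} = Any-resp-↭ (↭-sym (sortDesc-↭ l))

insertDesc-sorted-below : ∀ {x y} ys → x ≤ y → Linked _≥_ (y ∷ ys) → Linked _≥_ (y ∷ insertDesc x ys)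
insertDesc-sorted-below [] x≤y _ = x≤y ∷ [-]
insertDesc-sorted-below {x} (z ∷ zs) x≤y (y≥z ∷ sorted) with z ≤ᵇ x in e
... | true = x≤y ∷ ≤ᵇ-true⇒≤ e ∷ sorted
... | false = y≥z ∷ insertDesc-sorted-below zs (<⇒≤ (≤ᵇ-false⇒> e)) sorted

insertDesc-sorted : ∀ x ys → Linked _≥_ ys → Linked _≥_ (insertDesc x ys)
insertDesc-sorted x [] _ = [-]
insertDesc-sorted x (y ∷ ys) sorted with y ≤ᵇ x in e
... | true = ≤ᵇ-true⇒≤ e ∷ sorted
... | false = insertDesc-sorted-below ys (<⇒≤ (≤ᵇ-false⇒> e)) sorted

sortDesc-sorted : ∀ l → Linked _≥_ (sortDesc l)
sortDesc-sorted [] = []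
sortDesc-sorted (x ∷ l) = insertDesc-sorted x (sortDesc l) (sortDesc-sorted l)

insertDesc-smallest : ∀ x ys → All (x <_) ys → insertDesc x ys ≡ ys ∷ʳ x
insertDesc-smallest x [] [] = refl
insertDesc-smallest x (y ∷ ys) (x<y ∷ x<ys) with y ≤ᵇ x in e
... | true = ⊥-elim (<⇒≱ x<y (≤ᵇ-true⇒≤ e))
... | false = cong (y ∷_) (insertDesc-smallest x ys x<ys)

insertDesc-∷ʳ : ∀ p q ys → q ≤ p → insertDesc p (ys ∷ʳ q) ≡ insertDesc p ys ∷ʳ q
insertDesc-∷ʳ p q [] q≤p with q ≤ᵇ p in e
... | true = refl
... | false = ⊥-elim (<⇒≱ (≤ᵇ-false⇒> e) q≤p)
insertDesc-∷ʳ p q (y ∷ ys) q≤p with y ≤ᵇ p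
... | true = refl
... | false = cong (y ∷_) (insertDesc-∷ʳ p q ys q≤p)

sortDesc-smallest : ∀ p q R → q ≤ p → All (q <_) R → sortDesc (p ∷ q ∷ R) ≡ insertDesc p (sortDesc R) ∷ʳ q
sortDesc-smallest p q R q≤p q<R = begin
  insertDesc p (insertDesc q (sortDesc R)) ≡⟨ cong (insertDesc p) (insertDesc-smallest q (sortDesc R) (All-sortDesc q<R)) ⟩
  insertDesc p (sortDesc R ∷ʳ q)           ≡⟨ insertDesc-∷ʳ p q (sortDesc R) q≤p ⟩
  insertDesc p (sortDesc R) ∷ʳ q           ∎
  where open ≡-Reasoning

OddAtMost : ℕ → ℕ → Set
OddAtMost b x = Odd x → x ≤ b

maxOdd-upper : ∀ l → All (OddAtMost (maxOdd l)) l
maxOdd-upper [] = []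
maxOdd-upper (x ∷ l) with isOdd x in e
... | true = (λ _ → m≤m⊔n x (maxOdd l)) ∷ All.map (λ h o → ≤-trans (h o) (m≤n⊔m x (maxOdd l))) (maxOdd-upper l)
... | false = (λ o → ⊥-elim (isOdd⇒¬Odd x e o)) ∷ maxOdd-upper l

maxOdd-least : ∀ l b → All (OddAtMost b) l → maxOdd l ≤ b
maxOdd-least [] b _ = z≤n
maxOdd-least (x ∷ l) b (h ∷ hs) with isOdd x in e
... | true = ⊔-lub (h (isOdd⇒Odd x e)) (maxOdd-least l b hs)
... | false = maxOdd-least l b hs

maxOdd-zero-or-odd : ∀ l → maxOdd l ≡ 0 ⊎ Odd (maxOdd l)
maxOdd-zero-or-odd [] = inj₁ refl
maxOdd-zero-or-odd (x ∷ l) with isOdd x in e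
... | false = maxOdd-zero-or-odd l
... | true with maxOdd-zero-or-odd l
...   | inj₁ z rewrite z | ⊔-identityʳ x = inj₂ (isOdd⇒Odd x e)
...   | inj₂ o with ⊔-sel x (maxOdd l)
...     | inj₁ q rewrite q = inj₂ (isOdd⇒Odd x e)
...     | inj₂ q rewrite q = inj₂ o

Odd⇒positive : ∀ {n} → Odd n → 0 < n
Odd⇒positive {zero} ()
Odd⇒positive {suc n} _ = s≤s z≤n

maxOdd-positive : ∀ l → Any Odd l → 0 < maxOdd l
maxOdd-positive l = All.lookupWith (λ x≤max o → <-≤-trans (Odd⇒positive o) (x≤max o)) (maxOdd-upper l)

maxOdd-odd : ∀ l → Any Odd l → Odd (maxOdd l)
maxOdd-odd l odd-part with maxOdd-zero-or-odd l
... | inj₁ z = ⊥-elim (<⇒≢ (maxOdd-positive l odd-part) (sym z))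
... | inj₂ o = o

allEven-true : ∀ xs → allEven xs ≡ true → All (λ x → ¬ Odd x) xs
allEven-true [] _ = []
allEven-true (x ∷ xs) e with isOdd x in o
... | true with () ← e
... | false = isOdd⇒¬Odd x o ∷ allEven-true xs e

allEven-false : ∀ xs → allEven xs ≡ false → Any Odd xs
allEven-false (x ∷ xs) e with isOdd x in o
... | true = here (isOdd⇒Odd x o)
... | false = there (allEven-false xs e)

All-removeOne : ∀ {P : ℕ → Set} k l → All P l → All P (removeOne k l)
All-removeOne k [] [] = []
All-removeOne k (x ∷ l) (px ∷ pl) with x ≡ᵇ k
... | true = pl
... | false = px ∷ All-removeOne k l pl

Linked-∷ʳ⁺ : ∀ {A : Set} {R : A → A → Set} {x} xs → Linked R xs → All (λ y → R y x) xs → Linked R (xs ∷ʳ x)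
Linked-∷ʳ⁺ [] _ [] = [-]
Linked-∷ʳ⁺ (y ∷ []) _ (Ryx ∷ []) = Ryx ∷ [-]
Linked-∷ʳ⁺ (y ∷ z ∷ zs) (Ryz ∷ chain) (_ ∷ Rzsx) = Ryz ∷ Linked-∷ʳ⁺ (z ∷ zs) chain Rzsx

Linked-∷ʳ⁻ : ∀ {A : Set} {R : A → A → Set} {x} xs → Linked R (xs ∷ʳ x) → Linked R xs
Linked-∷ʳ⁻ [] _ = []
Linked-∷ʳ⁻ (y ∷ []) _ = [-]
Linked-∷ʳ⁻ (y ∷ z ∷ zs) (Ryz ∷ chain) = Ryz ∷ Linked-∷ʳ⁻ (z ∷ zs) chain

Pω-intro : ∀ ys b → Linked _≥_ (ys ∷ʳ b) → All (b <_) ys → All (OddAtMost (2 * b + 1)) (ys ∷ʳ b) → InPω (ys ∷ʳ b)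
Pω-intro ys b sorted b<ys odd-bound = sorted , ys , b , refl , b<ys , odd-bound

Pω-elim : ∀ xs a → InPω (xs ∷ʳ a) → Linked _≥_ (xs ∷ʳ a) × All (a <_) xs × All (OddAtMost (2 * a + 1)) xs
Pω-elim xs a (sorted , ys , b , eq , b<ys , odd-bound) with ∷ʳ-injective xs ys eq
... | refl , refl = sorted , b<ys , proj₁ (∷ʳ⁻ odd-bound)

halving-Pω : ∀ m R → All (m <_) R → All (OddAtMost (2 * m + 1)) R → InPω (sortDesc (suc m ∷ m ∷ R))
halving-Pω m R m<R odd-bound = subst InPω (sym sorted-form) (
  Pω-intro (insertDesc (suc m) (sortDesc R)) m
    (subst (Linked _≥_) sorted-form (sortDesc-sorted (suc m ∷ m ∷ R)))
    (All-insertDesc (n<1+n m) (All-sortDesc m<R))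
    (subst (All (OddAtMost (2 * m + 1))) sorted-form (All-sortDesc ((λ _ → 1+m≤2m+1 m) ∷ (λ _ → m≤2m+1 m) ∷ odd-bound))))
  where
  sorted-form : sortDesc (suc m ∷ m ∷ R) ≡ insertDesc (suc m) (sortDesc R) ∷ʳ m
  sorted-form = sortDesc-smallest (suc m) m R (n≤1+n m) m<R

splitOdd-Pω : ∀ κ a R → Odd κ → κ ≤ 2 * a + 1 → All (a <_) R → All (OddAtMost κ) R →
              InPω (sortDesc ((κ + 1) / 2 ∷ (κ ∸ 1) / 2 ∷ R))
splitOdd-Pω κ a R odd-κ κ≤ a<R odd-bound with Odd⇒2m+1 κ odd-κ
... | m , refl rewrite half-up m | half-down m =
  halving-Pω m R (All.map (≤-<-trans (2m+1-cancel-≤ m a κ≤)) a<R) odd-bound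

appendZero-Pω : ∀ φ → Linked _≥_ φ → All (0 <_) φ → All (λ x → ¬ Odd x) φ → InPω (φ ∷ʳ 0)
appendZero-Pω φ sorted positive even =
  Pω-intro φ 0 (Linked-∷ʳ⁺ φ sorted (All.map (λ _ → z≤n) positive)) positive
    (∷ʳ⁺ (All.map (λ ¬odd odd → ⊥-elim (¬odd odd)) even) (λ _ → z≤n))

φ⁺-bounds : ∀ xs a → All (a <_) xs → All (OddAtMost (2 * a + 1)) xs →
            All (a <_) (φ⁺ xs a) × All (OddAtMost (2 * a + 1)) (φ⁺ xs a)
φ⁺-bounds xs a a<xs odd-bound =
  All-sortDesc (∷ʳ⁺ a<xs (n<1+n a)) ,
  All-sortDesc (∷ʳ⁺ odd-bound (λ _ → 1+m≤2m+1 a))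

largestOddSplit-Pω : ∀ a φ → Any Odd φ → All (a <_) φ → All (OddAtMost (2 * a + 1)) φ →
                     InPω (sortDesc ((maxOdd φ + 1) / 2 ∷ (maxOdd φ ∸ 1) / 2 ∷ removeOne (maxOdd φ) φ))
largestOddSplit-Pω a φ odd-part a<φ odd-bound =
  splitOdd-Pω (maxOdd φ) a (removeOne (maxOdd φ) φ)
    (maxOdd-odd φ odd-part)
    (maxOdd-least φ (2 * a + 1) odd-bound)
    (All-removeOne (maxOdd φ) φ a<φ)
    (All-removeOne (maxOdd φ) φ (maxOdd-upper φ))

-- ψ₁⁺ preserves 𝒫_ω.  In case (i) a is odd, so a+1 is even and, with xs all
-- even, φ has no odd part; otherwise a+1 or some part of xs is odd.
ψ₁⁺-Pω : ∀ xs a → All (a <_) xs → All (OddAtMost (2 * a + 1)) xs → InPω (ψ₁⁺ xs a)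
ψ₁⁺-Pω xs a a<xs odd-bound
  with a<φ , φ-odd-bound ← φ⁺-bounds xs a a<xs odd-bound
     | isOdd a in odd-a | allEven xs in even-xs
... | true | true =
  appendZero-Pω (φ⁺ xs a) (sortDesc-sorted (xs ∷ʳ suc a)) (All.map (≤-<-trans z≤n) a<φ)
    (All-sortDesc (∷ʳ⁺ (allEven-true xs even-xs) (Odd⇒¬Odd-suc a (isOdd⇒Odd a odd-a))))
... | true | false =
  largestOddSplit-Pω a (φ⁺ xs a) (Any-sortDesc (++⁺ˡ (allEven-false xs even-xs))) a<φ φ-odd-bound
... | false | _ =
  largestOddSplit-Pω a (φ⁺ xs a) (Any-sortDesc (++⁺ʳ xs (here (¬Odd⇒Odd-suc a (isOdd⇒¬Odd a odd-a))))) a<φ φ-odd-bound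

ψ₂⁺-Pω : ∀ xs a → Linked _≥_ (xs ∷ʳ a) → All (a <_) xs → All (OddAtMost (2 * a + 1)) xs → InPω (ψ₂⁺ xs a)
ψ₂⁺-Pω xs a sorted a<xs odd-bound =
  Pω-intro (map (_+ 2) xs) (a + 1)
    (Linked-∷ʳ⁺ (map (_+ 2) xs) shifted-sorted (All.map <⇒≤ shifted-above))
    shifted-above
    (∷ʳ⁺ (map⁺ (All.map shifted-odd-bound odd-bound)) (λ _ → m≤2m+1 (a + 1)))
  where
  shifted-sorted : Linked _≥_ (map (_+ 2) xs)
  shifted-sorted = Linkedₚ.map⁺ (Linked.map (+-monoˡ-≤ 2) (Linked-∷ʳ⁻ xs sorted))
  shifted-above : All (a + 1 <_) (map (_+ 2) xs)
  shifted-above = map⁺ (All.map (λ a<x → +-mono-≤ a<x (s≤s z≤n)) a<xs)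
  shift-bound : ∀ k → 2 * k + 1 + 2 ≡ 2 * (k + 1) + 1
  shift-bound = solve-∀
  shifted-odd-bound : ∀ {x} → OddAtMost (2 * a + 1) x → OddAtMost (2 * (a + 1) + 1) (x + 2)
  shifted-odd-bound {x} bound odd = subst (x + 2 ≤_) (shift-bound a) (+-monoˡ-≤ 2 (bound (Odd-+2⁻ x odd)))

lemma2 : (xs : List ℕ) (a : ℕ) → InPω (xs ∷ʳ a) → InPω (ψ₁⁺ xs a) × InPω (ψ₂⁺ xs a)
lemma2 xs a in-Pω with sorted , a<xs , odd-bound ← Pω-elim xs a in-Pω =
  ψ₁⁺-Pω xs a a<xs odd-bound , ψ₂⁺-Pω xs a sorted a<xs odd-bound
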